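{- Let $(P^T_n)_{n\ge 0}$ be the sequence of polynomials in $m$ defined by $P^T_0(m)=0$, $P^T_1(m)=m$ and, for $n\ge 1$, $P^T_{n+1}(m)=P^T_n(m+1)+\sum_{k=1}^{n-1}P^T_k(m)\,P^T_{n-k}(m)$. For every $q\ge 0$, the polynomial $P^T_{2q+1}$ has degree $q+1$ and its leading coefficient (the coefficient of $m^{q+1}$) is the Catalan number $C_q=\frac{1}{q+1}\binom{2q}{q}$.
   Context: $P^T_n(m)$ counts untyped lambda terms of size $n$ with de Bruijn indices in $\{1,\dots,m\}$. -}

module Defs where

open import Data.Nat using (ℕ; zero; suc; _+_; _*_; _∸_; _<_; _/_)
open import Data.Nat.Combinatorics using (_C_)
open import Data.List using (List; []; _∷_; _++_; map; foldr; upTo)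
open import Relation.Binary.PropositionalEquality using (_≡_; _≢_)
open import Data.Product using (_×_)

-- Polynomials in one variable m with natural-number coefficients,
-- represented by coefficient lists, lowest degree first
-- (a₀ ∷ a₁ ∷ … represents a₀ + a₁ m + …). Trailing zeros are allowed;
-- degree is defined via coefficients, so representation does not matter.
Poly : Set
Poly = List ℕ

coeff : Poly → ℕ → ℕ
coeff []       _       = 0
coeff (a ∷ p)  zero    = a
coeff (a ∷ p)  (suc k) = coeff p k

infixl 6 _⊕_
infixl 7 _⊗_

_⊕_ : Poly → Poly → Poly
[]      ⊕ q       = q
(a ∷ p) ⊕ []      = a ∷ p
(a ∷ p) ⊕ (b ∷ q) = (a + b) ∷ (p ⊕ q)

_⊗_ : Poly → Poly → Poly
[]      ⊗ q = []
(a ∷ p) ⊗ q = map (a *_) q ⊕ (0 ∷ (p ⊗ q))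

sumP : List Poly → Poly
sumP = foldr _⊕_ []

-- shift p represents the polynomial m ↦ p(m+1)
-- (Horner: p(m) = a + m·p'(m), so p(m+1) = a + (m+1)·p'(m+1))
shift : Poly → Poly
shift []      = []
shift (a ∷ p) = (a ∷ []) ⊕ ((1 ∷ 1 ∷ []) ⊗ shift p)

get : List Poly → ℕ → Poly
get []      _       = []
get (p ∷ ps) zero    = p
get (p ∷ ps) (suc k) = get ps k

-- next n f computes P^T_{n+1} from f k = P^T_k (k ≤ n):
--   P_1(m) = m,
--   P_{n+1}(m) = P_n(m+1) + Σ_{k=1}^{n-1} P_k(m) P_{n-k}(m)   (n ≥ 1)
next : ℕ → (ℕ → Poly) → Poly
next zero    f = 0 ∷ 1 ∷ []
next (suc n') f =
  shift (f (suc n')) ⊕ sumP (map (λ j → f (suc j) ⊗ f (suc n' ∸ suc j)) (upTo n'))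

table : ℕ → List Poly
table zero    = [] ∷ []
table (suc n) = table n ++ (next n (get (table n)) ∷ [])

PT : ℕ → Poly
PT n = get (table n) n

HasDegree : Poly → ℕ → Set
HasDegree p d = (coeff p d ≢ 0) × (∀ k → d < k → coeff p k ≡ 0)

catalan : ℕ → ℕ
catalan q = ((2 * q) C q) / suc q

module Submission where

-- Polynomials are handled through their coefficient sequences ℕ → ℕ:
-- products become convolutions, degree bounds become "the coefficients
-- vanish from index d on".  First, the recurrence gives deg P_n ≤ ⌈n/2⌉
-- by strong induction (the shift m ↦ m+1 preserves degrees, and the
-- degrees of P_{j+1} P_{n-j} add up to at most ⌈(n+2)/2⌉).  So P_{2a} has
-- degree ≤ a, P_{2a+1} degree ≤ a+1, and the coefficient c_a of m^{a+1} in
-- P_{2a+1} obeys Segner's recurrence c_{r+1} = Σ_{a≤r} c_a c_{r-a}: only the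
-- products of two odd-index polynomials reach degree r+2 in P_{2r+3}.
-- Independently, the Catalan numbers are built from the ballot numbers
-- [x^k] C(x)^j of C = 1 + x C²; they satisfy the same recurrence and
-- (q+1) C_q = binom(2q, q).  Since Segner's recurrence determines its
-- solution, c_q = C_q ≠ 0, which with the degree bound is the theorem.

open import Defs
open import Data.Nat using (ℕ; suc; _+_; _*_)
open import Data.Product using (_×_)
open import Relation.Binary.PropositionalEquality using (_≡_)

open import Data.Nat using (zero; pred; _∸_; _≤_; _<_; z≤n; s≤s; _/_; ⌊_/2⌋; ⌈_/2⌉)
open import Data.Nat.Properties
open import Data.Nat.Combinatorics using (_C_; nCk≡nC[n∸k]; nCk+nC[k+1]≡[n+1]C[k+1]; nC1≡n)
open import Data.Nat.DivMod using (m*n/n≡m)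
open import Data.Nat.Induction using (<-rec)
open import Algebra.Properties.CommutativeSemigroup +-commutativeSemigroup
  using (interchange; x∙yz≈y∙xz; x∙yz≈xz∙y)
open import Data.List using ([]; _∷_; _++_; map; applyUpTo; length)
open import Data.List.Properties using (length-++)
open import Data.Product using (_,_)
open import Data.Sum using (inj₁; inj₂)
open import Function using (_∘_)
open import Relation.Binary.PropositionalEquality
  using (_≢_; refl; sym; trans; cong; cong₂; subst; subst₂; module ≡-Reasoning)
open ≡-Reasoning

Σ< : (ℕ → ℕ) → ℕ → ℕ
Σ< g zero    = 0
Σ< g (suc n) = g 0 + Σ< (g ∘ suc) n

Σ<-cong : ∀ {g h} n → (∀ j → j < n → g j ≡ h j) → Σ< g n ≡ Σ< h n
Σ<-cong zero    _  = refl
Σ<-cong (suc n) eq = cong₂ _+_ (eq 0 (s≤s z≤n)) (Σ<-cong n (λ j j<n → eq (suc j) (s≤s j<n)))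

Σ<-zero : ∀ {g} n → (∀ j → j < n → g j ≡ 0) → Σ< g n ≡ 0
Σ<-zero zero    _  = refl
Σ<-zero (suc n) eq = cong₂ _+_ (eq 0 (s≤s z≤n)) (Σ<-zero n (λ j j<n → eq (suc j) (s≤s j<n)))

-- double n = 2n, by a recursion that matches the parity splits below.
double : ℕ → ℕ
double zero    = zero
double (suc n) = suc (suc (double n))

double≡+ : ∀ n → double n ≡ n + n
double≡+ zero    = refl
double≡+ (suc n) = cong suc (trans (cong suc (double≡+ n)) (sym (+-suc n n)))

Σ<-parity : ∀ g n → Σ< g (suc (double n)) ≡ Σ< (g ∘ double) (suc n) + Σ< (g ∘ suc ∘ double) n
Σ<-parity g zero    = sym (+-identityʳ (g 0 + 0))
Σ<-parity g (suc n) = begin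
  g 0 + (g 1 + Σ< (g ∘ suc ∘ suc) (suc (double n)))
    ≡⟨ cong (λ s → g 0 + (g 1 + s)) (Σ<-parity (g ∘ suc ∘ suc) n) ⟩
  g 0 + (g 1 + (evens + odds))
    ≡⟨ cong (g 0 +_) (x∙yz≈y∙xz (g 1) evens odds) ⟩
  g 0 + (evens + (g 1 + odds))
    ≡⟨ sym (+-assoc (g 0) evens (g 1 + odds)) ⟩
  (g 0 + evens) + (g 1 + odds) ∎
  where
  evens odds : ℕ
  evens = Σ< (g ∘ suc ∘ suc ∘ double) (suc n)
  odds  = Σ< (g ∘ suc ∘ suc ∘ suc ∘ double) n

conv : (ℕ → ℕ) → (ℕ → ℕ) → ℕ → ℕ
conv f g zero    = f 0 * g 0
conv f g (suc k) = f 0 * g (suc k) + conv (f ∘ suc) g k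

conv-as-Σ< : ∀ f g n → Σ< (λ j → f j * g (n ∸ j)) (suc n) ≡ conv f g n
conv-as-Σ< f g zero    = +-identityʳ (f 0 * g 0)
conv-as-Σ< f g (suc n) = cong (f 0 * g (suc n) +_) (conv-as-Σ< (f ∘ suc) g n)

conv-cong : ∀ {f f′ g g′} k → (∀ i → i ≤ k → f i ≡ f′ i) → (∀ i → i ≤ k → g i ≡ g′ i) →
            conv f g k ≡ conv f′ g′ k
conv-cong zero    ef eg = cong₂ _*_ (ef 0 z≤n) (eg 0 z≤n)
conv-cong (suc k) ef eg = cong₂ _+_ (cong₂ _*_ (ef 0 z≤n) (eg (suc k) ≤-refl))
  (conv-cong k (λ i i≤k → ef (suc i) (s≤s i≤k)) (λ i i≤k → eg i (m≤n⇒m≤1+n i≤k)))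

conv-zeroˡ : ∀ g k → conv (λ _ → 0) g k ≡ 0
conv-zeroˡ g zero    = refl
conv-zeroˡ g (suc k) = conv-zeroˡ g k

conv-zeroʳ : ∀ f k → conv f (λ _ → 0) k ≡ 0
conv-zeroʳ f zero    = *-zeroʳ (f 0)
conv-zeroʳ f (suc k) = cong₂ _+_ (*-zeroʳ (f 0)) (conv-zeroʳ (f ∘ suc) k)

conv-distribʳ-+ : ∀ f g h k → conv f (λ i → g i + h i) k ≡ conv f g k + conv f h k
conv-distribʳ-+ f g h zero    = *-distribˡ-+ (f 0) (g 0) (h 0)
conv-distribʳ-+ f g h (suc k) = begin
  f 0 * (g (suc k) + h (suc k)) + conv (f ∘ suc) (λ i → g i + h i) k
    ≡⟨ cong₂ _+_ (*-distribˡ-+ (f 0) (g (suc k)) (h (suc k))) (conv-distribʳ-+ (f ∘ suc) g h k) ⟩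
  (f 0 * g (suc k) + f 0 * h (suc k)) + (conv (f ∘ suc) g k + conv (f ∘ suc) h k)
    ≡⟨ interchange (f 0 * g (suc k)) (f 0 * h (suc k)) (conv (f ∘ suc) g k) (conv (f ∘ suc) h k) ⟩
  (f 0 * g (suc k) + conv (f ∘ suc) g k) + (f 0 * h (suc k) + conv (f ∘ suc) h k) ∎

conv-last : ∀ f g k → conv f g (suc k) ≡ f (suc k) * g 0 + conv f (g ∘ suc) k
conv-last f g zero    = +-comm (f 0 * g 1) (f 1 * g 0)
conv-last f g (suc k) = begin
  f 0 * g (suc (suc k)) + conv (f ∘ suc) g (suc k)
    ≡⟨ cong (f 0 * g (suc (suc k)) +_) (conv-last (f ∘ suc) g k) ⟩
  f 0 * g (suc (suc k)) + (f (suc (suc k)) * g 0 + conv (f ∘ suc) (g ∘ suc) k)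
    ≡⟨ x∙yz≈y∙xz (f 0 * g (suc (suc k))) (f (suc (suc k)) * g 0) (conv (f ∘ suc) (g ∘ suc) k) ⟩
  f (suc (suc k)) * g 0 + (f 0 * g (suc (suc k)) + conv (f ∘ suc) (g ∘ suc) k) ∎

_VanishesFrom_ : (ℕ → ℕ) → ℕ → Set
f VanishesFrom d = ∀ k → d ≤ k → f k ≡ 0

conv-constˡ : ∀ f g → f VanishesFrom 1 → ∀ k → conv f g k ≡ f 0 * g k
conv-constˡ f g v zero    = refl
conv-constˡ f g v (suc k) = begin
  f 0 * g (suc k) + conv (f ∘ suc) g k
    ≡⟨ cong (f 0 * g (suc k) +_) (trans (conv-cong k (λ i _ → v (suc i) (s≤s z≤n)) (λ _ _ → refl)) (conv-zeroˡ g k)) ⟩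
  f 0 * g (suc k) + 0
    ≡⟨ +-identityʳ _ ⟩
  f 0 * g (suc k) ∎

conv-vanishes : ∀ {f g} d₁ d₂ → f VanishesFrom suc d₁ → g VanishesFrom d₂ → conv f g VanishesFrom (d₁ + d₂)
conv-vanishes {f} {g} zero d₂ vf vg k d₂≤k = begin
  conv f g k  ≡⟨ conv-constˡ f g vf k ⟩
  f 0 * g k   ≡⟨ cong (f 0 *_) (vg k d₂≤k) ⟩
  f 0 * 0     ≡⟨ *-zeroʳ (f 0) ⟩
  0           ∎
conv-vanishes (suc d₁) d₂ vf vg zero ()
conv-vanishes {f} {g} (suc d₁) d₂ vf vg (suc k) (s≤s d≤k) = begin
  f 0 * g (suc k) + conv (f ∘ suc) g k
    ≡⟨ cong₂ _+_ (cong (f 0 *_) (vg (suc k) d₂≤1+k)) (conv-vanishes d₁ d₂ (λ i d₁<i → vf (suc i) (s≤s d₁<i)) vg k d≤k) ⟩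
  f 0 * 0 + 0
    ≡⟨ cong (_+ 0) (*-zeroʳ (f 0)) ⟩
  0 ∎
  where
  d₂≤1+k : d₂ ≤ suc k
  d₂≤1+k = m≤n⇒m≤1+n (≤-trans (m≤n+m d₂ d₁) d≤k)

conv-top : ∀ {f g} d₁ d₂ → f VanishesFrom suc d₁ → g VanishesFrom suc d₂ → conv f g (d₁ + d₂) ≡ f d₁ * g d₂
conv-top {f} {g} zero     d₂ vf vg = conv-constˡ f g vf d₂
conv-top {f} {g} (suc d₁) d₂ vf vg = begin
  f 0 * g (suc (d₁ + d₂)) + conv (f ∘ suc) g (d₁ + d₂)
    ≡⟨ cong₂ _+_ (cong (f 0 *_) (vg _ (s≤s (m≤n+m d₂ d₁)))) (conv-top d₁ d₂ (λ i d₁<i → vf (suc i) (s≤s d₁<i)) vg) ⟩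
  f 0 * 0 + f (suc d₁) * g d₂
    ≡⟨ cong (_+ f (suc d₁) * g d₂) (*-zeroʳ (f 0)) ⟩
  f (suc d₁) * g d₂ ∎

coeff-⊕ : ∀ p q k → coeff (p ⊕ q) k ≡ coeff p k + coeff q k
coeff-⊕ []      q       k       = refl
coeff-⊕ (a ∷ p) []      k       = sym (+-identityʳ _)
coeff-⊕ (a ∷ p) (b ∷ q) zero    = refl
coeff-⊕ (a ∷ p) (b ∷ q) (suc k) = coeff-⊕ p q k

coeff-scale : ∀ a q k → coeff (map (a *_) q) k ≡ a * coeff q k
coeff-scale a []      k       = sym (*-zeroʳ a)
coeff-scale a (b ∷ q) zero    = refl
coeff-scale a (b ∷ q) (suc k) = coeff-scale a q k

coeff-⊗ : ∀ p q k → coeff (p ⊗ q) k ≡ conv (coeff p) (coeff q) k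
coeff-⊗ []      q k       = sym (conv-zeroˡ (coeff q) k)
coeff-⊗ (a ∷ p) q zero    =
  trans (coeff-⊕ (map (a *_) q) (0 ∷ p ⊗ q) 0) (trans (+-identityʳ _) (coeff-scale a q 0))
coeff-⊗ (a ∷ p) q (suc k) =
  trans (coeff-⊕ (map (a *_) q) (0 ∷ p ⊗ q) (suc k)) (cong₂ _+_ (coeff-scale a q (suc k)) (coeff-⊗ p q k))

coeff-sumP : ∀ (h : ℕ → Poly) f n k →
             coeff (sumP (map h (applyUpTo f n))) k ≡ Σ< (λ j → coeff (h (f j)) k) n
coeff-sumP h f zero    k = refl
coeff-sumP h f (suc n) k =
  trans (coeff-⊕ (h (f 0)) _ k) (cong (coeff (h (f 0)) k +_) (coeff-sumP h (f ∘ suc) n k))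

coeff-1+m : ∀ s k → coeff ((1 ∷ 1 ∷ []) ⊗ s) k ≡ coeff s k + coeff (0 ∷ s) k
coeff-1+m s k = trans (coeff-⊗ (1 ∷ 1 ∷ []) s k) (by-index k)
  where
  one-vanishes : coeff (1 ∷ []) VanishesFrom 1
  one-vanishes (suc i) _ = refl
  by-index : ∀ k → conv (coeff (1 ∷ 1 ∷ [])) (coeff s) k ≡ coeff s k + coeff (0 ∷ s) k
  by-index zero    = trans (*-identityˡ _) (sym (+-identityʳ _))
  by-index (suc k) = cong₂ _+_ (*-identityˡ _)
    (trans (conv-constˡ (coeff (1 ∷ [])) (coeff s) one-vanishes k) (*-identityˡ _))

tail-vanishes : ∀ {a p d} → coeff (a ∷ p) VanishesFrom d → coeff p VanishesFrom pred d
tail-vanishes {d = zero}  v k _   = v (suc k) z≤n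
tail-vanishes {d = suc d} v k d≤k = v (suc k) (s≤s d≤k)

cons0-vanishes : ∀ {p d} → coeff p VanishesFrom pred d → coeff (0 ∷ p) VanishesFrom d
cons0-vanishes v zero    _       = refl
cons0-vanishes v (suc k) d≤1+k = v k (pred-mono-≤ d≤1+k)

shift-vanishes : ∀ p d → coeff p VanishesFrom d → coeff (shift p) VanishesFrom d
shift-vanishes []      d v k d≤k = refl
shift-vanishes (a ∷ p) d v k d≤k = begin
  coeff ((a ∷ []) ⊕ ((1 ∷ 1 ∷ []) ⊗ shift p)) k
    ≡⟨ coeff-⊕ (a ∷ []) ((1 ∷ 1 ∷ []) ⊗ shift p) k ⟩
  coeff (a ∷ []) k + coeff ((1 ∷ 1 ∷ []) ⊗ shift p) k
    ≡⟨ cong₂ _+_ (constant-term k d≤k) (coeff-1+m (shift p) k) ⟩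
  coeff (shift p) k + coeff (0 ∷ shift p) k
    ≡⟨ cong₂ _+_ (tail-bound k (≤-trans pred[n]≤n d≤k)) (cons0-vanishes tail-bound k d≤k) ⟩
  0 ∎
  where
  tail-bound : coeff (shift p) VanishesFrom pred d
  tail-bound = shift-vanishes p (pred d) (tail-vanishes v)
  constant-term : ∀ k → d ≤ k → coeff (a ∷ []) k ≡ 0
  constant-term zero    d≤0 = v 0 d≤0
  constant-term (suc k) _   = refl

length-table : ∀ n → length (table n) ≡ suc n
length-table zero    = refl
length-table (suc n) =
  trans (length-++ (table n)) (trans (+-comm (length (table n)) 1) (cong suc (length-table n)))

get-++-last : ∀ xs y → get (xs ++ y ∷ []) (length xs) ≡ y
get-++-last []       y = refl
get-++-last (x ∷ xs) y = get-++-last xs y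

get-++-init : ∀ xs ys k → k < length xs → get (xs ++ ys) k ≡ get xs k
get-++-init (x ∷ xs) ys zero    _         = refl
get-++-init (x ∷ xs) ys (suc k) (s≤s k<n) = get-++-init xs ys k k<n

PT-suc : ∀ n → PT (suc n) ≡ next n (get (table n))
PT-suc n = subst (λ i → get (table n ++ new ∷ []) i ≡ new) (length-table n) (get-++-last (table n) new)
  where
  new : Poly
  new = next n (get (table n))

get-table : ∀ {n k} → k ≤ n → get (table n) k ≡ PT k
get-table k≤n with m≤n⇒m<n∨m≡n k≤n
... | inj₂ refl = refl
get-table {suc n} {k} _ | inj₁ (s≤s k≤n) =
  trans (get-++-init (table n) _ k (subst (k <_) (sym (length-table n)) (s≤s k≤n))) (get-table k≤n)

coeff-next : ∀ n f k → coeff (next (suc n) f) k ≡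
  coeff (shift (f (suc n))) k + Σ< (λ j → conv (coeff (f (suc j))) (coeff (f (n ∸ j))) k) n
coeff-next n f k = begin
  coeff (shift (f (suc n)) ⊕ sumP (map product (applyUpTo (λ j → j) n))) k
    ≡⟨ coeff-⊕ (shift (f (suc n))) _ k ⟩
  coeff (shift (f (suc n))) k + coeff (sumP (map product (applyUpTo (λ j → j) n))) k
    ≡⟨ cong (coeff (shift (f (suc n))) k +_) (coeff-sumP product (λ j → j) n k) ⟩
  coeff (shift (f (suc n))) k + Σ< (λ j → coeff (product j) k) n
    ≡⟨ cong (coeff (shift (f (suc n))) k +_) (Σ<-cong n (λ j _ → coeff-⊗ (f (suc j)) (f (n ∸ j)) k)) ⟩
  coeff (shift (f (suc n))) k + Σ< (λ j → conv (coeff (f (suc j))) (coeff (f (n ∸ j))) k) n ∎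
  where
  product : ℕ → Poly
  product j = f (suc j) ⊗ f (n ∸ j)

PT-coeff : ∀ n k → coeff (PT (suc (suc n))) k ≡
  coeff (shift (PT (suc n))) k + Σ< (λ j → conv (coeff (PT (suc j))) (coeff (PT (n ∸ j))) k) n
PT-coeff n k = begin
  coeff (PT (suc (suc n))) k
    ≡⟨ cong (λ p → coeff p k) (PT-suc (suc n)) ⟩
  coeff (next (suc n) T) k
    ≡⟨ coeff-next n T k ⟩
  coeff (shift (T (suc n))) k + Σ< (λ j → conv (coeff (T (suc j))) (coeff (T (n ∸ j))) k) n
    ≡⟨ cong₂ _+_ (cong (λ p → coeff (shift p) k) (get-table {suc n} ≤-refl)) (Σ<-cong n from-table) ⟩
  coeff (shift (PT (suc n))) k + Σ< (λ j → conv (coeff (PT (suc j))) (coeff (PT (n ∸ j))) k) n ∎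
  where
  T : ℕ → Poly
  T = get (table (suc n))
  from-table : ∀ j → j < n →
    conv (coeff (T (suc j))) (coeff (T (n ∸ j))) k ≡ conv (coeff (PT (suc j))) (coeff (PT (n ∸ j))) k
  from-table j j<n = cong₂ (λ p p′ → conv (coeff p) (coeff p′) k)
    (get-table (s≤s (<⇒≤ j<n))) (get-table (m≤n⇒m≤1+n (m∸n≤m n j)))

⌊a/2⌋+⌈b/2⌉≤⌈[a+b]/2⌉ : ∀ a b → ⌊ a /2⌋ + ⌈ b /2⌉ ≤ ⌈ a + b /2⌉
⌊a/2⌋+⌈b/2⌉≤⌈[a+b]/2⌉ zero          b = ≤-refl
⌊a/2⌋+⌈b/2⌉≤⌈[a+b]/2⌉ (suc zero)    b = ⌈n/2⌉-mono (n≤1+n b)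
⌊a/2⌋+⌈b/2⌉≤⌈[a+b]/2⌉ (suc (suc a)) b = s≤s (⌊a/2⌋+⌈b/2⌉≤⌈[a+b]/2⌉ a b)

-- The degree bounds of the factors of P_{j+1} P_{n-j} add up to at most
-- the bound ⌈(n+2)/2⌉ for P_{n+2}.
product-degrees : ∀ {j n} → j ≤ n → ⌈ suc j /2⌉ + suc ⌈ n ∸ j /2⌉ ≤ suc (suc ⌈ n /2⌉)
product-degrees {j} {n} j≤n =
  subst (_≤ suc (suc ⌈ n /2⌉)) (cong suc (sym (+-suc ⌊ j /2⌋ ⌈ n ∸ j /2⌉)))
    (s≤s (s≤s (subst (λ m → ⌊ j /2⌋ + ⌈ n ∸ j /2⌉ ≤ ⌈ m /2⌉) (m+[n∸m]≡n j≤n)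
      (⌊a/2⌋+⌈b/2⌉≤⌈[a+b]/2⌉ j (n ∸ j)))))

DegreeBound : ℕ → Set
DegreeBound n = coeff (PT n) VanishesFrom suc ⌈ n /2⌉

degree-bound : ∀ n → DegreeBound n
degree-bound = <-rec DegreeBound step
  where
  step : ∀ n → (∀ {m} → m < n → DegreeBound m) → DegreeBound n
  step zero          _  k             _       = refl
  step (suc zero)    _  (suc zero)    (s≤s ())
  step (suc zero)    _  (suc (suc k)) _       = refl
  step (suc (suc n)) IH k             bound = begin
    coeff (PT (suc (suc n))) k
      ≡⟨ PT-coeff n k ⟩
    coeff (shift (PT (suc n))) k + Σ< (λ j → conv (coeff (PT (suc j))) (coeff (PT (n ∸ j))) k) n
      ≡⟨ cong₂ _+_ shifted (Σ<-zero n product) ⟩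
    0 ∎
    where
    shifted : coeff (shift (PT (suc n))) k ≡ 0
    shifted = shift-vanishes (PT (suc n)) _ (IH ≤-refl) k
      (≤-trans (s≤s (⌈n/2⌉-mono (n≤1+n (suc n)))) bound)
    product : ∀ j → j < n → conv (coeff (PT (suc j))) (coeff (PT (n ∸ j))) k ≡ 0
    product j j<n = conv-vanishes ⌈ suc j /2⌉ (suc ⌈ n ∸ j /2⌉)
      (IH (s≤s (m≤n⇒m≤1+n j<n))) (IH (s≤s (m≤n⇒m≤1+n (m∸n≤m n j)))) k
      (≤-trans (product-degrees (<⇒≤ j<n)) bound)

⌊double/2⌋ : ∀ a → ⌊ double a /2⌋ ≡ a
⌊double/2⌋ zero    = refl
⌊double/2⌋ (suc a) = cong suc (⌊double/2⌋ a)

⌊1+double/2⌋ : ∀ a → ⌊ suc (double a) /2⌋ ≡ a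
⌊1+double/2⌋ zero    = refl
⌊1+double/2⌋ (suc a) = cong suc (⌊1+double/2⌋ a)

even-degree-bound : ∀ a → coeff (PT (double a)) VanishesFrom suc a
even-degree-bound a =
  subst (λ d → coeff (PT (double a)) VanishesFrom suc d) (⌊1+double/2⌋ a) (degree-bound (double a))

odd-degree-bound : ∀ a → coeff (PT (suc (double a))) VanishesFrom suc (suc a)
odd-degree-bound a =
  subst (λ d → coeff (PT (suc (double a))) VanishesFrom suc (suc d)) (⌊double/2⌋ a) (degree-bound (suc (double a)))

-- ballot k j = [x^k] C(x)^j for the Catalan series C = 1 + x C², computed
-- from C^{j+1} = C^j + x C^{j+2}.
ballot : ℕ → ℕ → ℕ
ballot zero    j       = 1
ballot (suc k) zero    = 0
ballot (suc k) (suc j) = ballot (suc k) j + ballot k (suc (suc j))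

catalanSeq : ℕ → ℕ
catalanSeq k = ballot k 1

ballot-pos : ∀ k j → 1 ≤ ballot k (suc j)
ballot-pos zero    j = s≤s z≤n
ballot-pos (suc k) j = ≤-trans (ballot-pos k (suc j)) (m≤n+m _ (ballot (suc k) j))

ballot-conv : ∀ k j → conv catalanSeq (λ t → ballot t j) k ≡ ballot k (suc j)
ballot-conv zero    j       = refl
ballot-conv (suc k) zero    = begin
  conv catalanSeq (λ t → ballot t 0) (suc k)
    ≡⟨ conv-last catalanSeq (λ t → ballot t 0) k ⟩
  catalanSeq (suc k) * 1 + conv catalanSeq (λ _ → 0) k
    ≡⟨ cong₂ _+_ (*-identityʳ _) (conv-zeroʳ catalanSeq k) ⟩
  catalanSeq (suc k) + 0
    ≡⟨ +-identityʳ _ ⟩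
  catalanSeq (suc k) ∎
ballot-conv (suc k) (suc j) = begin
  conv catalanSeq (λ t → ballot t (suc j)) (suc k)
    ≡⟨ conv-last catalanSeq (λ t → ballot t (suc j)) k ⟩
  catalanSeq (suc k) * 1 + conv catalanSeq (λ t → ballot (suc t) j + ballot t (suc (suc j))) k
    ≡⟨ cong (catalanSeq (suc k) * 1 +_) (conv-distribʳ-+ catalanSeq (λ t → ballot (suc t) j) (λ t → ballot t (suc (suc j))) k) ⟩
  catalanSeq (suc k) * 1 + (conv catalanSeq (λ t → ballot (suc t) j) k + conv catalanSeq (λ t → ballot t (suc (suc j))) k)
    ≡⟨ sym (+-assoc (catalanSeq (suc k) * 1) _ _) ⟩
  (catalanSeq (suc k) * 1 + conv catalanSeq (λ t → ballot (suc t) j) k) + conv catalanSeq (λ t → ballot t (suc (suc j))) k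
    ≡⟨ cong₂ _+_ (trans (sym (conv-last catalanSeq (λ t → ballot t j) k)) (ballot-conv (suc k) j))
                 (ballot-conv k (suc (suc j))) ⟩
  ballot (suc k) (suc (suc j)) ∎

catalan-rec : ∀ k → catalanSeq (suc k) ≡ conv catalanSeq catalanSeq k
catalan-rec k = sym (ballot-conv k 1)

segner-unique : ∀ {c c′} → c 0 ≡ c′ 0 → (∀ r → c (suc r) ≡ conv c c r) → (∀ r → c′ (suc r) ≡ conv c′ c′ r) →
                ∀ q → c q ≡ c′ q
segner-unique {c} {c′} base rec rec′ = <-rec (λ q → c q ≡ c′ q) step
  where
  step : ∀ q → (∀ {p} → p < q → c p ≡ c′ p) → c q ≡ c′ q
  step zero    _  = base
  step (suc r) IH = begin
    c (suc r)      ≡⟨ rec r ⟩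
    conv c c r     ≡⟨ conv-cong r agree agree ⟩
    conv c′ c′ r   ≡⟨ sym (rec′ r) ⟩
    c′ (suc r)     ∎
    where
    agree : ∀ i → i ≤ r → c i ≡ c′ i
    agree i i≤r = IH (s≤s i≤r)

_C⁻_ : ℕ → ℕ → ℕ
n C⁻ zero  = 0
n C⁻ suc k = n C k

pascal : ∀ n k → suc n C suc k ≡ n C k + n C suc k
pascal n k = sym (nCk+nC[k+1]≡[n+1]C[k+1] n k)

pascal⁻ : ∀ n k → suc n C k ≡ n C k + n C⁻ k
pascal⁻ n zero    = refl
pascal⁻ n (suc k) = trans (pascal n k) (+-comm (n C k) (n C suc k))

C-sym : ∀ a b → (a + b) C a ≡ (a + b) C b
C-sym a b = trans (nCk≡nC[n∸k] (m≤m+n a b)) (cong ((a + b) C_) (m+n∸m≡n a b))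

C-central : ∀ k → suc (double k) C suc k ≡ suc (double k) C k
C-central k = subst (λ n → n C suc k ≡ n C k) (cong suc (sym (double≡+ k))) (C-sym (suc k) k)

ballot-binomial : ∀ K j → ballot K (suc j) + (j + double K) C⁻ K ≡ (j + double K) C K
ballot-binomial zero    j    = refl
ballot-binomial (suc k) zero = begin
  ballot k 2 + suc M C k
    ≡⟨ cong (ballot k 2 +_) (pascal⁻ M k) ⟩
  ballot k 2 + (M C k + M C⁻ k)
    ≡⟨ x∙yz≈xz∙y (ballot k 2) (M C k) (M C⁻ k) ⟩
  (ballot k 2 + M C⁻ k) + M C k
    ≡⟨ cong (_+ M C k) (ballot-binomial k 1) ⟩
  M C k + M C k
    ≡⟨ cong (M C k +_) (sym (C-central k)) ⟩
  M C k + M C suc k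
    ≡⟨ sym (pascal M k) ⟩
  suc M C suc k ∎
  where
  M : ℕ
  M = suc (double k)
ballot-binomial (suc k) (suc j) = begin
  (b₁ + b₂) + suc N C k
    ≡⟨ cong ((b₁ + b₂) +_) (pascal⁻ N k) ⟩
  (b₁ + b₂) + (N C k + N C⁻ k)
    ≡⟨ interchange b₁ b₂ (N C k) (N C⁻ k) ⟩
  (b₁ + N C k) + (b₂ + N C⁻ k)
    ≡⟨ cong₂ _+_ (ballot-binomial (suc k) j) IH₂ ⟩
  N C suc k + N C k
    ≡⟨ +-comm (N C suc k) (N C k) ⟩
  N C k + N C suc k
    ≡⟨ sym (pascal N k) ⟩
  suc N C suc k ∎
  where
  N b₁ b₂ : ℕ
  N  = j + double (suc k)
  b₁ = ballot (suc k) (suc j)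
  b₂ = ballot k (suc (suc (suc j)))
  N≡ : suc (suc (j + double k)) ≡ N
  N≡ = sym (trans (+-suc j (suc (double k))) (cong suc (+-suc j (double k))))
  IH₂ : b₂ + N C⁻ k ≡ N C k
  IH₂ = subst (λ n → b₂ + n C⁻ k ≡ n C k) N≡ (ballot-binomial k (suc (suc j)))

absorption : ∀ n k → suc k * (suc n C suc k) ≡ suc n * (n C k)
absorption n       zero    = trans (*-identityˡ _) (trans (nC1≡n (suc n)) (sym (*-identityʳ (suc n))))
absorption zero    (suc k) = *-zeroʳ (suc (suc k))
absorption (suc n) (suc k) = begin
  suc (suc k) * (suc (suc n) C suc (suc k))
    ≡⟨ cong (suc (suc k) *_) (pascal (suc n) (suc k)) ⟩
  suc (suc k) * (x + y)
    ≡⟨ *-distribˡ-+ (suc (suc k)) x y ⟩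
  (x + suc k * x) + suc (suc k) * y
    ≡⟨ cong₂ _+_ (cong (x +_) (absorption n k)) (absorption n (suc k)) ⟩
  (x + suc n * (n C k)) + suc n * (n C suc k)
    ≡⟨ +-assoc x (suc n * (n C k)) (suc n * (n C suc k)) ⟩
  x + (suc n * (n C k) + suc n * (n C suc k))
    ≡⟨ cong (x +_) (sym (*-distribˡ-+ (suc n) (n C k) (n C suc k))) ⟩
  x + suc n * (n C k + n C suc k)
    ≡⟨ cong (λ z → x + suc n * z) (sym (pascal n k)) ⟩
  x + suc n * x ∎
  where
  x y : ℕ
  x = suc n C suc k
  y = suc n C suc (suc k)

central-ratio : ∀ p → suc (suc p) * (double (suc p) C p) ≡ suc p * (double (suc p) C suc p)
central-ratio p = begin
  suc (suc p) * (D C p)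
    ≡⟨ cong (suc (suc p) *_) complement ⟩
  suc (suc p) * (D C suc (suc p))
    ≡⟨ absorption (suc (double p)) (suc p) ⟩
  D * (suc (double p) C suc p)
    ≡⟨ cong (D *_) (C-central p) ⟩
  D * (suc (double p) C p)
    ≡⟨ sym (absorption (suc (double p)) p) ⟩
  suc p * (D C suc p) ∎
  where
  D : ℕ
  D = double (suc p)
  D≡ : p + suc (suc p) ≡ D
  D≡ = trans (+-suc p (suc p)) (cong suc (trans (+-suc p p) (cong suc (sym (double≡+ p)))))
  complement : D C p ≡ D C suc (suc p)
  complement = subst (λ n → n C p ≡ n C suc (suc p)) D≡ (C-sym p (suc (suc p)))

catalan-binomial : ∀ q → suc q * catalanSeq q ≡ double q C q
catalan-binomial zero    = refl
catalan-binomial (suc p) = +-cancelʳ-≡ (suc p * A) (suc (suc p) * catalanSeq (suc p)) A (begin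
  suc (suc p) * catalanSeq (suc p) + suc p * A
    ≡⟨ cong (suc (suc p) * catalanSeq (suc p) +_) (sym (central-ratio p)) ⟩
  suc (suc p) * catalanSeq (suc p) + suc (suc p) * B
    ≡⟨ sym (*-distribˡ-+ (suc (suc p)) (catalanSeq (suc p)) B) ⟩
  suc (suc p) * (catalanSeq (suc p) + B)
    ≡⟨ cong (suc (suc p) *_) (ballot-binomial (suc p) 0) ⟩
  A + suc p * A ∎)
  where
  A B : ℕ
  A = double (suc p) C suc p
  B = double (suc p) C p

double≡2* : ∀ q → double q ≡ 2 * q
double≡2* q = trans (double≡+ q) (cong (q +_) (sym (+-identityʳ q)))

catalan≡catalanSeq : ∀ q → catalan q ≡ catalanSeq q
catalan≡catalanSeq q = begin
  ((2 * q) C q) / suc q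
    ≡⟨ cong (λ n → (n C q) / suc q) (sym (double≡2* q)) ⟩
  (double q C q) / suc q
    ≡⟨ cong (_/ suc q) (sym (catalan-binomial q)) ⟩
  (suc q * catalanSeq q) / suc q
    ≡⟨ cong (_/ suc q) (*-comm (suc q) (catalanSeq q)) ⟩
  (catalanSeq q * suc q) / suc q
    ≡⟨ m*n/n≡m (catalanSeq q) (suc q) ⟩
  catalanSeq q ∎

lead : ℕ → ℕ
lead a = coeff (PT (suc (double a))) (suc a)

double∸double : ∀ r a → double r ∸ double a ≡ double (r ∸ a)
double∸double r       zero    = refl
double∸double zero    (suc a) = refl
double∸double (suc r) (suc a) = double∸double r a

1+double∸double : ∀ {r a} → a ≤ r → suc (double r) ∸ double a ≡ suc (double (r ∸ a))
1+double∸double {r}     {zero}  _         = refl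
1+double∸double {suc r} {suc a} (s≤s a≤r) = 1+double∸double a≤r

degrees-add-up : ∀ {a r} → a ≤ r → suc a + suc (r ∸ a) ≡ suc (suc r)
degrees-add-up {a} {r} a≤r = cong suc (trans (+-suc a (r ∸ a)) (cong suc (m+[n∸m]≡n a≤r)))

-- The coefficient of m^{r+2} in P_{2r+3}: the shifted term and the products
-- of two even-index polynomials have degree ≤ r+1, so only the products
-- P_{2a+1} P_{2(r-a)+1} contribute, each with lead a · lead (r − a).
lead-rec : ∀ r → lead (suc r) ≡ conv lead lead r
lead-rec r = begin
  lead (suc r)
    ≡⟨ PT-coeff (suc (double r)) (suc (suc r)) ⟩
  coeff (shift (PT (double (suc r)))) (suc (suc r)) + Σ< term (suc (double r))
    ≡⟨ cong₂ _+_ shifted (Σ<-parity term r) ⟩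
  Σ< (term ∘ double) (suc r) + Σ< (term ∘ suc ∘ double) r
    ≡⟨ cong₂ _+_ (Σ<-cong (suc r) odd-times-odd) (Σ<-zero r even-times-even) ⟩
  Σ< (λ a → lead a * lead (r ∸ a)) (suc r) + 0
    ≡⟨ +-identityʳ _ ⟩
  Σ< (λ a → lead a * lead (r ∸ a)) (suc r)
    ≡⟨ conv-as-Σ< lead lead r ⟩
  conv lead lead r ∎
  where
  term : ℕ → ℕ
  term j = conv (coeff (PT (suc j))) (coeff (PT (suc (double r) ∸ j))) (suc (suc r))
  shifted : coeff (shift (PT (double (suc r)))) (suc (suc r)) ≡ 0
  shifted = shift-vanishes (PT (double (suc r))) (suc (suc r)) (even-degree-bound (suc r)) (suc (suc r)) ≤-refl
  odd-times-odd : ∀ a → a < suc r → term (double a) ≡ lead a * lead (r ∸ a)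
  odd-times-odd a (s≤s a≤r) = begin
    term (double a)
      ≡⟨ cong (λ i → conv f (coeff (PT i)) (suc (suc r))) (1+double∸double a≤r) ⟩
    conv f g (suc (suc r))
      ≡⟨ cong (conv f g) (sym (degrees-add-up a≤r)) ⟩
    conv f g (suc a + suc (r ∸ a))
      ≡⟨ conv-top (suc a) (suc (r ∸ a)) (odd-degree-bound a) (odd-degree-bound (r ∸ a)) ⟩
    lead a * lead (r ∸ a) ∎
    where
    f g : ℕ → ℕ
    f = coeff (PT (suc (double a)))
    g = coeff (PT (suc (double (r ∸ a))))
  even-times-even : ∀ a → a < r → term (suc (double a)) ≡ 0
  even-times-even a a<r = conv-vanishes (suc a) (suc (r ∸ a))
    (even-degree-bound (suc a))
    (subst (λ i → coeff (PT i) VanishesFrom suc (r ∸ a)) (sym (double∸double r a)) (even-degree-bound (r ∸ a)))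
    (suc (suc r)) (≤-reflexive (degrees-add-up (<⇒≤ a<r)))

lead≡catalanSeq : ∀ q → lead q ≡ catalanSeq q
lead≡catalanSeq = segner-unique refl lead-rec catalan-rec

mainTheorem2 : (q : ℕ) →
    HasDegree (PT (2 * q + 1)) (q + 1) × coeff (PT (2 * q + 1)) (q + 1) ≡ catalan q
mainTheorem2 q = subst₂ (λ n d → HasDegree (PT n) d × coeff (PT n) d ≡ catalan q)
  (trans (cong suc (double≡2* q)) (+-comm 1 (2 * q))) (+-comm 1 q)
  ((lead-nonzero , odd-degree-bound q) , lead≡catalan)
  where
  lead≡catalan : lead q ≡ catalan q
  lead≡catalan = trans (lead≡catalanSeq q) (sym (catalan≡catalanSeq q))
  lead-nonzero : lead q ≢ 0
  lead-nonzero = subst (_≢ 0) (sym (lead≡catalanSeq q)) (n>0⇒n≢0 (ballot-pos q 0))
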